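{- For every integer $k\ge 1$, the following is an identity of polynomials in $z$: \[ \binom{k(z+1)-1}{k-1}=\frac{1}{k}\sum_{q=0}^{k-1}(k-q)\binom{k(z+1)}{q}z^{k-q-1}. \]
   Context: Binomial coefficients with polynomial upper argument are understood as polynomials: $\binom{x}{q}=\frac{x(x-1)\cdots(x-q+1)}{q!}$. -}

module Defs where

-- Univariate polynomials over ℚ, represented by coefficient lists
-- (the i-th entry is the coefficient of z^i).  Two polynomials are equal
-- iff all their coefficients agree (trailing zeros are irrelevant).

open import Data.Nat as ℕ using (ℕ; zero; suc; _!)
open import Data.Nat.Properties using (_!≢0)
open import Data.Integer as ℤ using (ℤ; +_)
open import Data.Rational as ℚ using (ℚ; 0ℚ; 1ℚ)
open import Data.List using (List; []; _∷_)
open import Relation.Binary.PropositionalEquality using (_≡_)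

Poly : Set
Poly = List ℚ

coeff : Poly → ℕ → ℚ
coeff []       _       = 0ℚ
coeff (a ∷ p)  zero    = a
coeff (a ∷ p)  (suc n) = coeff p n

infix 4 _≈P_
_≈P_ : Poly → Poly → Set
p ≈P q = ∀ n → coeff p n ≡ coeff q n

constP : ℚ → Poly
constP a = a ∷ []

ℕ→ℚ : ℕ → ℚ
ℕ→ℚ n = (+ n) ℚ./ 1

Z : Poly
Z = 0ℚ ∷ 1ℚ ∷ []

infixl 6 _⊕_
infixl 7 _⊗_ _·_

_⊕_ : Poly → Poly → Poly
[]      ⊕ q       = q
p       ⊕ []      = p
(a ∷ p) ⊕ (b ∷ q) = (a ℚ.+ b) ∷ (p ⊕ q)

_·_ : ℚ → Poly → Poly
c · []      = []
c · (a ∷ p) = (c ℚ.* a) ∷ (c · p)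

_⊗_ : Poly → Poly → Poly
[]      ⊗ q = []
(a ∷ p) ⊗ q = (a · q) ⊕ (0ℚ ∷ (p ⊗ q))

_^P_ : Poly → ℕ → Poly
p ^P zero  = constP 1ℚ
p ^P suc n = p ⊗ (p ^P n)

falling : Poly → ℕ → Poly
falling p zero    = constP 1ℚ
falling p (suc q) = falling p q ⊗ (p ⊕ constP (ℚ.- ℕ→ℚ q))

binomP : Poly → ℕ → Poly
binomP p q = ((+ 1) ℚ./ (q !)) {{q !≢0}} · falling p q

sumP : ℕ → (ℕ → Poly) → Poly
sumP zero    f = []
sumP (suc n) f = sumP n f ⊕ f n

module Submission where

-- Write k = m+1, N = k(z+1) and M = N-1.  The partial
-- sums  S_i = Σ_{q≤i} (k-q) C(N,q) z^(k-q-1)  have the closed form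
--     S_i = k C(M,i) z^(m-i)      (0 ≤ i ≤ m),
-- and at i = m this says S_m = k C(M,m), which is the claim after dividing by k.
-- The step from i to i+1 combines Pascal's rule C(N,i+1) = C(M,i+1) + C(M,i),
-- the absorption rule (i+1) C(M,i+1) = C(M,i) (M-i), and M - i = kz + (m-i).

open import Data.Nat as ℕ using (ℕ; zero; suc; _∸_; _!; NonZero)
import Data.Nat.Properties as ℕₚ
open import Data.Nat.Properties using (_!≢0)
open import Data.Integer as ℤ using (+_)
import Data.Integer.Properties as ℤₚ
open import Data.Rational as ℚ using (ℚ; 0ℚ; 1ℚ; _+_; _*_; -_; _/_; toℚᵘ)
open import Data.Rational.Properties
  using ( _≟_; +-*-commutativeRing; +-identityˡ; +-identityʳ; +-comm; +-assoc
        ; neg-distrib-+; *-zeroˡ; *-zeroʳ; *-identityˡ; *-identityʳ; *-assoc; *-comm; *-distribˡ-+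
        ; toℚᵘ-injective; toℚᵘ-fromℚᵘ; toℚᵘ-homo-+; toℚᵘ-homo-* )
open import Data.Rational.Unnormalised as ℚᵘ using (mkℚᵘ; *≡*)
import Data.Rational.Unnormalised.Properties as ℚᵘₚ
open import Data.List using ([]; _∷_)
open import Data.Maybe using (Maybe; just; nothing)
open import Data.Product using (_,_)
open import Level using (0ℓ)
open import Relation.Binary using (IsEquivalence; Setoid)
open import Relation.Binary.PropositionalEquality
  using (_≡_; refl; sym; trans; cong; cong₂; module ≡-Reasoning)
open import Relation.Nullary using (yes)
open import Relation.Nullary.Decidable.Core using (dec⇒maybe)
open import Algebra.Bundles using (CommutativeRing)
open import Tactic.RingSolver using (solve-∀)
open import Tactic.RingSolver.Core.AlmostCommutativeRing
  using (AlmostCommutativeRing; fromCommutativeRing)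
import Relation.Binary.Reasoning.Setoid as SetoidReasoning

open import Defs

ℚ-ring : AlmostCommutativeRing 0ℓ 0ℓ
ℚ-ring = fromCommutativeRing +-*-commutativeRing (λ x → dec⇒maybe (0ℚ ≟ x))

interchange : ∀ a b c d → (a + b) + (c + d) ≡ (a + c) + (b + d)
interchange = solve-∀ ℚ-ring

*-leftComm : ∀ a b c → a * (b * c) ≡ b * (a * c)
*-leftComm = solve-∀ ℚ-ring

coeff-⊕ : ∀ p q n → coeff (p ⊕ q) n ≡ coeff p n + coeff q n
coeff-⊕ []      q       n       = sym (+-identityˡ _)
coeff-⊕ (a ∷ p) []      n       = sym (+-identityʳ _)
coeff-⊕ (a ∷ p) (b ∷ q) zero    = refl
coeff-⊕ (a ∷ p) (b ∷ q) (suc n) = coeff-⊕ p q n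

coeff-· : ∀ c p n → coeff (c · p) n ≡ c * coeff p n
coeff-· c []      n       = sym (*-zeroʳ c)
coeff-· c (a ∷ p) zero    = refl
coeff-· c (a ∷ p) (suc n) = coeff-· c p n

_⋆_ : (ℕ → ℚ) → (ℕ → ℚ) → ℕ → ℚ
(f ⋆ g) zero    = f 0 * g 0
(f ⋆ g) (suc n) = f 0 * g (suc n) + ((λ i → f (suc i)) ⋆ g) n

⋆-cong : ∀ {f f′ g g′} → (∀ i → f i ≡ f′ i) → (∀ i → g i ≡ g′ i) →
         ∀ n → (f ⋆ g) n ≡ (f′ ⋆ g′) n
⋆-cong ef eg zero    = cong₂ _*_ (ef 0) (eg 0)
⋆-cong ef eg (suc n) =
  cong₂ _+_ (cong₂ _*_ (ef 0) (eg (suc n))) (⋆-cong (λ i → ef (suc i)) eg n)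

⋆-zeroˡ : ∀ g n → ((λ _ → 0ℚ) ⋆ g) n ≡ 0ℚ
⋆-zeroˡ g zero    = *-zeroˡ (g 0)
⋆-zeroˡ g (suc n) = trans (cong₂ _+_ (*-zeroˡ (g (suc n))) (⋆-zeroˡ g n)) (+-identityˡ 0ℚ)

⋆-distribˡ : ∀ f g h n → (f ⋆ (λ i → g i + h i)) n ≡ (f ⋆ g) n + (f ⋆ h) n
⋆-distribˡ f g h zero    = *-distribˡ-+ (f 0) (g 0) (h 0)
⋆-distribˡ f g h (suc n) =
  trans (cong₂ _+_ (*-distribˡ-+ (f 0) (g (suc n)) (h (suc n))) (⋆-distribˡ (λ i → f (suc i)) g h n))
        (interchange (f 0 * g (suc n)) (f 0 * h (suc n)) _ _)

⋆-scaleʳ : ∀ c f g n → (f ⋆ (λ i → c * g i)) n ≡ c * (f ⋆ g) n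
⋆-scaleʳ c f g zero    = *-leftComm (f 0) c (g 0)
⋆-scaleʳ c f g (suc n) =
  trans (cong₂ _+_ (*-leftComm (f 0) c (g (suc n))) (⋆-scaleʳ c (λ i → f (suc i)) g n))
        (sym (*-distribˡ-+ c _ _))

coeff-⊗ : ∀ p q n → coeff (p ⊗ q) n ≡ (coeff p ⋆ coeff q) n
coeff-⊗ []      q n       = sym (⋆-zeroˡ (coeff q) n)
coeff-⊗ (a ∷ p) q zero    =
  trans (coeff-⊕ (a · q) (0ℚ ∷ p ⊗ q) 0) (trans (+-identityʳ _) (coeff-· a q 0))
coeff-⊗ (a ∷ p) q (suc n) =
  trans (coeff-⊕ (a · q) (0ℚ ∷ p ⊗ q) (suc n)) (cong₂ _+_ (coeff-· a q (suc n)) (coeff-⊗ p q n))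

-- Coefficientwise equality, packaged as a record so that both polynomials can be
-- recovered from a proof; this is the equality of the polynomial ring.
infix 4 _≋_
record _≋_ (p q : Poly) : Set where
  constructor coeffwise
  field coeff-≡ : p ≈P q
open _≋_

≋-refl : ∀ {p} → p ≋ p
≋-refl = coeffwise λ _ → refl

≋-sym : ∀ {p q} → p ≋ q → q ≋ p
≋-sym (coeffwise e) = coeffwise λ n → sym (e n)

≋-trans : ∀ {p q r} → p ≋ q → q ≋ r → p ≋ r
≋-trans (coeffwise e) (coeffwise f) = coeffwise λ n → trans (e n) (f n)

≋-reflexive : ∀ {p q} → p ≡ q → p ≋ q
≋-reflexive refl = ≋-refl

≋-isEquivalence : IsEquivalence _≋_
≋-isEquivalence = record { refl = ≋-refl ; sym = ≋-sym ; trans = ≋-trans }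

≋-setoid : Setoid 0ℓ 0ℓ
≋-setoid = record { isEquivalence = ≋-isEquivalence }

module ≋-Reasoning = SetoidReasoning ≋-setoid

∷-cong : ∀ {a b p q} → a ≡ b → p ≋ q → a ∷ p ≋ b ∷ q
∷-cong a≡b (coeffwise e) = coeffwise λ { zero → a≡b ; (suc n) → e n }

zero∷[]≋[] : 0ℚ ∷ [] ≋ []
zero∷[]≋[] = coeffwise λ { zero → refl ; (suc n) → refl }

⊕-cong : ∀ {p p′ q q′} → p ≋ p′ → q ≋ q′ → p ⊕ q ≋ p′ ⊕ q′
⊕-cong {p} {p′} {q} {q′} (coeffwise e) (coeffwise f) = coeffwise λ n →
  trans (coeff-⊕ p q n) (trans (cong₂ _+_ (e n) (f n)) (sym (coeff-⊕ p′ q′ n)))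

⊕-comm : ∀ p q → p ⊕ q ≋ q ⊕ p
⊕-comm p q = coeffwise λ n →
  trans (coeff-⊕ p q n) (trans (+-comm (coeff p n) _) (sym (coeff-⊕ q p n)))

⊕-assoc : ∀ p q r → (p ⊕ q) ⊕ r ≋ p ⊕ (q ⊕ r)
⊕-assoc p q r = coeffwise λ n → begin
  coeff ((p ⊕ q) ⊕ r) n                ≡⟨ coeff-⊕ (p ⊕ q) r n ⟩
  coeff (p ⊕ q) n + coeff r n          ≡⟨ cong (_+ coeff r n) (coeff-⊕ p q n) ⟩
  (coeff p n + coeff q n) + coeff r n  ≡⟨ +-assoc (coeff p n) _ _ ⟩
  coeff p n + (coeff q n + coeff r n)  ≡⟨ cong₂ _+_ (refl {x = coeff p n}) (coeff-⊕ q r n) ⟨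
  coeff p n + coeff (q ⊕ r) n          ≡⟨ coeff-⊕ p (q ⊕ r) n ⟨
  coeff (p ⊕ (q ⊕ r)) n                ∎
  where open ≡-Reasoning

⊕-identityʳ : ∀ p → p ⊕ [] ≋ p
⊕-identityʳ p = coeffwise λ n → trans (coeff-⊕ p [] n) (+-identityʳ (coeff p n))

negP : Poly → Poly
negP p = (- 1ℚ) · p

⊕-inverseʳ : ∀ p → p ⊕ negP p ≋ []
⊕-inverseʳ p = coeffwise λ n →
  trans (coeff-⊕ p (negP p) n) (trans (cong₂ _+_ (refl {x = coeff p n}) (coeff-· (- 1ℚ) p n)) (cancel (coeff p n)))
  where
  cancel : ∀ x → x + (- 1ℚ) * x ≡ 0ℚ
  cancel = solve-∀ ℚ-ring

·-cong : ∀ {c d p q} → c ≡ d → p ≋ q → c · p ≋ d · q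
·-cong {c} {d} {p} {q} c≡d (coeffwise e) = coeffwise λ n →
  trans (coeff-· c p n) (trans (cong₂ _*_ c≡d (e n)) (sym (coeff-· d q n)))

·-distrib : ∀ c p q → c · (p ⊕ q) ≋ c · p ⊕ c · q
·-distrib c p q = coeffwise λ n → begin
  coeff (c · (p ⊕ q)) n              ≡⟨ coeff-· c (p ⊕ q) n ⟩
  c * coeff (p ⊕ q) n                ≡⟨ cong (c *_) (coeff-⊕ p q n) ⟩
  c * (coeff p n + coeff q n)        ≡⟨ *-distribˡ-+ c (coeff p n) _ ⟩
  c * coeff p n + c * coeff q n      ≡⟨ cong₂ _+_ (coeff-· c p n) (coeff-· c q n) ⟨
  coeff (c · p) n + coeff (c · q) n  ≡⟨ coeff-⊕ (c · p) (c · q) n ⟨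
  coeff (c · p ⊕ c · q) n            ∎
  where open ≡-Reasoning

·-assoc : ∀ c d p → c · (d · p) ≋ (c * d) · p
·-assoc c d p = coeffwise λ n →
  trans (coeff-· c (d · p) n) (trans (cong (c *_) (coeff-· d p n))
    (trans (sym (*-assoc c d (coeff p n))) (sym (coeff-· (c * d) p n))))

·-identity : ∀ p → 1ℚ · p ≋ p
·-identity p = coeffwise λ n → trans (coeff-· 1ℚ p n) (*-identityˡ (coeff p n))

·-zero : ∀ p → 0ℚ · p ≋ []
·-zero p = coeffwise λ n → trans (coeff-· 0ℚ p n) (*-zeroˡ (coeff p n))

⊗-cong : ∀ {p p′ q q′} → p ≋ p′ → q ≋ q′ → p ⊗ q ≋ p′ ⊗ q′
⊗-cong {p} {p′} {q} {q′} (coeffwise e) (coeffwise f) = coeffwise λ n →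
  trans (coeff-⊗ p q n) (trans (⋆-cong e f n) (sym (coeff-⊗ p′ q′ n)))

⊗-distribˡ : ∀ p q r → p ⊗ (q ⊕ r) ≋ p ⊗ q ⊕ p ⊗ r
⊗-distribˡ p q r = coeffwise λ n → begin
  coeff (p ⊗ (q ⊕ r)) n                     ≡⟨ coeff-⊗ p (q ⊕ r) n ⟩
  (coeff p ⋆ coeff (q ⊕ r)) n               ≡⟨ ⋆-cong (λ _ → refl) (coeff-⊕ q r) n ⟩
  (coeff p ⋆ (λ i → coeff q i + coeff r i)) n ≡⟨ ⋆-distribˡ (coeff p) (coeff q) (coeff r) n ⟩
  (coeff p ⋆ coeff q) n + (coeff p ⋆ coeff r) n ≡⟨ cong₂ _+_ (coeff-⊗ p q n) (coeff-⊗ p r n) ⟨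
  coeff (p ⊗ q) n + coeff (p ⊗ r) n         ≡⟨ coeff-⊕ (p ⊗ q) (p ⊗ r) n ⟨
  coeff (p ⊗ q ⊕ p ⊗ r) n                   ∎
  where open ≡-Reasoning

⊗-scaleʳ : ∀ c p q → p ⊗ (c · q) ≋ c · (p ⊗ q)
⊗-scaleʳ c p q = coeffwise λ n → begin
  coeff (p ⊗ (c · q)) n              ≡⟨ coeff-⊗ p (c · q) n ⟩
  (coeff p ⋆ coeff (c · q)) n        ≡⟨ ⋆-cong (λ _ → refl) (coeff-· c q) n ⟩
  (coeff p ⋆ (λ i → c * coeff q i)) n ≡⟨ ⋆-scaleʳ c (coeff p) (coeff q) n ⟩
  c * (coeff p ⋆ coeff q) n          ≡⟨ cong (c *_) (coeff-⊗ p q n) ⟨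
  c * coeff (p ⊗ q) n                ≡⟨ coeff-· c (p ⊗ q) n ⟨
  coeff (c · (p ⊗ q)) n              ∎
  where open ≡-Reasoning

⊗-zeroʳ : ∀ p → p ⊗ [] ≋ []
⊗-zeroʳ []      = ≋-refl
⊗-zeroʳ (a ∷ p) = ≋-trans (∷-cong refl (⊗-zeroʳ p)) zero∷[]≋[]

⊗-consʳ : ∀ a p q → q ⊗ (a ∷ p) ≋ a · q ⊕ (0ℚ ∷ q ⊗ p)
⊗-consʳ a p []      = ≋-sym zero∷[]≋[]
⊗-consʳ a p (b ∷ q) = ∷-cong (cong (_+ 0ℚ) (*-comm b a)) (begin
  b · p ⊕ q ⊗ (a ∷ p)                ≈⟨ ⊕-cong (≋-refl {b · p}) (⊗-consʳ a p q) ⟩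
  b · p ⊕ (a · q ⊕ (0ℚ ∷ q ⊗ p))     ≈⟨ ⊕-assoc (b · p) (a · q) _ ⟨
  (b · p ⊕ a · q) ⊕ (0ℚ ∷ q ⊗ p)     ≈⟨ ⊕-cong (⊕-comm (b · p) (a · q)) ≋-refl ⟩
  (a · q ⊕ b · p) ⊕ (0ℚ ∷ q ⊗ p)     ≈⟨ ⊕-assoc (a · q) (b · p) _ ⟩
  a · q ⊕ (b · p ⊕ (0ℚ ∷ q ⊗ p))     ∎)
  where open ≋-Reasoning

⊗-comm : ∀ p q → p ⊗ q ≋ q ⊗ p
⊗-comm []      q = ≋-sym (⊗-zeroʳ q)
⊗-comm (a ∷ p) q =
  ≋-trans (⊕-cong (≋-refl {a · q}) (∷-cong refl (⊗-comm p q))) (≋-sym (⊗-consʳ a p q))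

⊗-distribʳ : ∀ r p q → (p ⊕ q) ⊗ r ≋ p ⊗ r ⊕ q ⊗ r
⊗-distribʳ r p q = ≋-trans (⊗-comm (p ⊕ q) r)
  (≋-trans (⊗-distribˡ r p q) (⊕-cong (⊗-comm r p) (⊗-comm r q)))

⊗-scaleˡ : ∀ c p q → (c · p) ⊗ q ≋ c · (p ⊗ q)
⊗-scaleˡ c p q = ≋-trans (⊗-comm (c · p) q) (≋-trans (⊗-scaleʳ c q p) (·-cong refl (⊗-comm q p)))

⊗-assoc : ∀ p q r → (p ⊗ q) ⊗ r ≋ p ⊗ (q ⊗ r)
⊗-assoc []      q r = ≋-refl
⊗-assoc (a ∷ p) q r = begin
  (a · q ⊕ (0ℚ ∷ p ⊗ q)) ⊗ r            ≈⟨ ⊗-distribʳ r (a · q) (0ℚ ∷ p ⊗ q) ⟩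
  (a · q) ⊗ r ⊕ (0ℚ · r ⊕ (0ℚ ∷ (p ⊗ q) ⊗ r)) ≈⟨ ⊕-cong (⊗-scaleˡ a q r) (⊕-cong (·-zero r) (∷-cong refl (⊗-assoc p q r))) ⟩
  a · (q ⊗ r) ⊕ (0ℚ ∷ p ⊗ (q ⊗ r))      ∎
  where open ≋-Reasoning

⊗-identityˡ : ∀ p → constP 1ℚ ⊗ p ≋ p
⊗-identityˡ p = ≋-trans (⊕-cong (·-identity p) zero∷[]≋[]) (⊕-identityʳ p)

⊗-identityʳ : ∀ p → p ⊗ constP 1ℚ ≋ p
⊗-identityʳ p = ≋-trans (⊗-comm p _) (⊗-identityˡ p)

polyRing : CommutativeRing 0ℓ 0ℓ
polyRing = record
  { Carrier = Poly ; _≈_ = _≋_ ; _+_ = _⊕_ ; _*_ = _⊗_ ; -_ = negP ; 0# = [] ; 1# = constP 1ℚ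
  ; isCommutativeRing = record
    { isRing = record
      { +-isAbelianGroup = record
        { isGroup = record
          { isMonoid = record
            { isSemigroup = record
              { isMagma = record { isEquivalence = ≋-isEquivalence ; ∙-cong = ⊕-cong }
              ; assoc = ⊕-assoc }
            ; identity = (λ _ → ≋-refl) , ⊕-identityʳ }
          ; inverse = (λ p → ≋-trans (⊕-comm (negP p) p) (⊕-inverseʳ p)) , ⊕-inverseʳ
          ; ⁻¹-cong = ·-cong refl }
        ; comm = ⊕-comm }
      ; *-cong = ⊗-cong
      ; *-assoc = ⊗-assoc
      ; *-identity = ⊗-identityˡ , ⊗-identityʳ
      ; distrib = ⊗-distribˡ , ⊗-distribʳ }
    ; *-comm = ⊗-comm } }

-- A polynomial is recognised as zero by checking its coefficients; the solver
-- uses this to discard vanishing terms of normal forms.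
zero? : ∀ p → Maybe ([] ≋ p)
zero? []      = just ≋-refl
zero? (a ∷ p) with 0ℚ ≟ a | zero? p
... | yes refl | just e = just (≋-trans (≋-sym zero∷[]≋[]) (∷-cong refl e))
... | _        | _      = nothing

poly-ring : AlmostCommutativeRing 0ℓ 0ℓ
poly-ring = fromCommutativeRing polyRing zero?

-- Scalar multiplication is multiplication by a constant polynomial, and
-- constants negate as polynomials do; these let scalars enter ring-solver goals.
·-as-⊗ : ∀ c p → c · p ≋ constP c ⊗ p
·-as-⊗ c p = ≋-sym (≋-trans (⊕-cong (≋-refl {c · p}) zero∷[]≋[]) (⊕-identityʳ (c · p)))

constP-neg : ∀ a → constP (- a) ≋ negP (constP a)
constP-neg a = ∷-cong (neg-as-scaling a) ≋-refl
  where
  neg-as-scaling : ∀ x → - x ≡ (- 1ℚ) * x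
  neg-as-scaling = solve-∀ ℚ-ring

toℚᵘ-ℕ→ℚ : ∀ n → toℚᵘ (ℕ→ℚ n) ℚᵘ.≃ mkℚᵘ (+ n) 0
toℚᵘ-ℕ→ℚ n = toℚᵘ-fromℚᵘ (mkℚᵘ (+ n) 0)

ℕ→ℚ-+ : ∀ a b → ℕ→ℚ (a ℕ.+ b) ≡ ℕ→ℚ a + ℕ→ℚ b
ℕ→ℚ-+ a b = toℚᵘ-injective (begin
  toℚᵘ (ℕ→ℚ (a ℕ.+ b))              ≈⟨ toℚᵘ-ℕ→ℚ (a ℕ.+ b) ⟩
  mkℚᵘ (+ (a ℕ.+ b)) 0              ≈⟨ *≡* (cong (ℤ._* + 1) (trans (ℤₚ.pos-+ a b)
                                         (sym (cong₂ ℤ._+_ (ℤₚ.*-identityʳ (+ a)) (ℤₚ.*-identityʳ (+ b)))))) ⟩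
  mkℚᵘ (+ a) 0 ℚᵘ.+ mkℚᵘ (+ b) 0    ≈⟨ ℚᵘₚ.+-cong (toℚᵘ-ℕ→ℚ a) (toℚᵘ-ℕ→ℚ b) ⟨
  toℚᵘ (ℕ→ℚ a) ℚᵘ.+ toℚᵘ (ℕ→ℚ b)    ≈⟨ toℚᵘ-homo-+ (ℕ→ℚ a) (ℕ→ℚ b) ⟨
  toℚᵘ (ℕ→ℚ a + ℕ→ℚ b)              ∎)
  where open ℚᵘₚ.≃-Reasoning

ℕ→ℚ-* : ∀ a b → ℕ→ℚ (a ℕ.* b) ≡ ℕ→ℚ a * ℕ→ℚ b
ℕ→ℚ-* a b = toℚᵘ-injective (begin
  toℚᵘ (ℕ→ℚ (a ℕ.* b))              ≈⟨ toℚᵘ-ℕ→ℚ (a ℕ.* b) ⟩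
  mkℚᵘ (+ (a ℕ.* b)) 0              ≈⟨ *≡* (cong (ℤ._* + 1) (ℤₚ.pos-* a b)) ⟩
  mkℚᵘ (+ a) 0 ℚᵘ.* mkℚᵘ (+ b) 0    ≈⟨ ℚᵘₚ.*-cong (toℚᵘ-ℕ→ℚ a) (toℚᵘ-ℕ→ℚ b) ⟨
  toℚᵘ (ℕ→ℚ a) ℚᵘ.* toℚᵘ (ℕ→ℚ b)    ≈⟨ toℚᵘ-homo-* (ℕ→ℚ a) (ℕ→ℚ b) ⟨
  toℚᵘ (ℕ→ℚ a * ℕ→ℚ b)              ∎)
  where open ℚᵘₚ.≃-Reasoning

-- 1/n is inverse to n: in ℚᵘ the fraction 1/(d+1) is literally 1/ ((d+1)/1).
inverse-ℕ→ℚ : ∀ n .{{_ : NonZero n}} → (+ 1 / n) * ℕ→ℚ n ≡ 1ℚ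
inverse-ℕ→ℚ (suc d) = toℚᵘ-injective (begin
  toℚᵘ ((+ 1 / suc d) * ℕ→ℚ (suc d))            ≈⟨ toℚᵘ-homo-* (+ 1 / suc d) (ℕ→ℚ (suc d)) ⟩
  toℚᵘ (+ 1 / suc d) ℚᵘ.* toℚᵘ (ℕ→ℚ (suc d))    ≈⟨ ℚᵘₚ.*-cong (toℚᵘ-fromℚᵘ (mkℚᵘ (+ 1) d)) (toℚᵘ-ℕ→ℚ (suc d)) ⟩
  ℚᵘ.1/ mkℚᵘ (+ suc d) 0 ℚᵘ.* mkℚᵘ (+ suc d) 0  ≈⟨ ℚᵘₚ.*-inverseˡ (mkℚᵘ (+ suc d) 0) ⟩
  ℚᵘ.1ℚᵘ                                        ∎)
  where open ℚᵘₚ.≃-Reasoning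

ifac : ℕ → ℚ
ifac q = (+ 1 / (q !)) {{q !≢0}}

-- (q+1) · 1/(q+1)! = 1/q!, because (q+1)! = (q+1) · q!.
ifac-suc : ∀ q → ℕ→ℚ (suc q) * ifac (suc q) ≡ ifac q
ifac-suc q = begin
  s * u                     ≡⟨ *-identityʳ (s * u) ⟨
  (s * u) * 1ℚ              ≡⟨ cong ((s * u) *_) (inverse-ℕ→ℚ (q !) {{q !≢0}}) ⟨
  (s * u) * (v * f)         ≡⟨ regroup s u v f ⟩
  (u * (s * f)) * v         ≡⟨ cong (λ x → (u * x) * v) (ℕ→ℚ-* (suc q) (q !)) ⟨
  (u * ℕ→ℚ (suc q !)) * v   ≡⟨ cong (_* v) (inverse-ℕ→ℚ (suc q !) {{_!≢0 (suc q)}}) ⟩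
  1ℚ * v                    ≡⟨ *-identityˡ v ⟩
  v                         ∎
  where
  open ≡-Reasoning
  s = ℕ→ℚ (suc q)
  u = ifac (suc q)
  v = ifac q
  f = ℕ→ℚ (q !)
  regroup : ∀ s u v f → (s * u) * (v * f) ≡ (u * (s * f)) * v
  regroup = solve-∀ ℚ-ring

lower : Poly → Poly
lower p = p ⊕ constP (- ℕ→ℚ 1)

lower-shift : ∀ p q → lower p ⊕ constP (- ℕ→ℚ q) ≋ p ⊕ constP (- ℕ→ℚ (suc q))
lower-shift p q = ≋-trans (⊕-assoc p _ _) (⊕-cong (≋-refl {p}) (∷-cong negated-sum ≋-refl))
  where
  negated-sum : - ℕ→ℚ 1 + - ℕ→ℚ q ≡ - ℕ→ℚ (suc q)
  negated-sum = trans (sym (neg-distrib-+ (ℕ→ℚ 1) (ℕ→ℚ q))) (cong -_ (sym (ℕ→ℚ-+ 1 q)))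

falling-lower : ∀ p q → falling p (suc q) ≋ p ⊗ falling (lower p) q
falling-lower p zero = begin
  constP 1ℚ ⊗ (p ⊕ constP (- ℕ→ℚ 0))  ≈⟨ ⊗-identityˡ _ ⟩
  p ⊕ (0ℚ ∷ [])                      ≈⟨ ⊕-cong (≋-refl {p}) zero∷[]≋[] ⟩
  p ⊕ []                             ≈⟨ ⊕-identityʳ p ⟩
  p                                  ≈⟨ ⊗-identityʳ p ⟨
  p ⊗ constP 1ℚ                      ∎
  where open ≋-Reasoning
falling-lower p (suc q) = begin
  falling p (suc q) ⊗ (p ⊕ constP (- ℕ→ℚ (suc q)))
    ≈⟨ ⊗-cong (falling-lower p q) ≋-refl ⟩
  (p ⊗ falling (lower p) q) ⊗ (p ⊕ constP (- ℕ→ℚ (suc q)))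
    ≈⟨ ⊗-assoc p _ _ ⟩
  p ⊗ (falling (lower p) q ⊗ (p ⊕ constP (- ℕ→ℚ (suc q))))
    ≈⟨ ⊗-cong (≋-refl {p}) (⊗-cong (≋-refl {falling (lower p) q}) (lower-shift p q)) ⟨
  p ⊗ (falling (lower p) q ⊗ (lower p ⊕ constP (- ℕ→ℚ q)))
    ∎
  where open ≋-Reasoning

-- (p-1)⋯(p-1-q) + (q+1) (p-1)⋯(p-q) = (p-1)⋯(p-q) · p, since (p-q-1) + (q+1) = p.
falling-split : ∀ p q →
  falling (lower p) (suc q) ⊕ ℕ→ℚ (suc q) · falling (lower p) q ≋ falling (lower p) q ⊗ p
falling-split p q = begin
  F ⊗ (lower p ⊕ constP (- ℕ→ℚ q)) ⊕ ℕ→ℚ (suc q) · F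
    ≈⟨ ⊕-cong (⊗-cong (≋-refl {F}) (≋-trans (lower-shift p q) (⊕-cong (≋-refl {p}) (constP-neg c))))
              (·-as-⊗ c F) ⟩
  F ⊗ (p ⊕ negP (constP c)) ⊕ constP c ⊗ F
    ≈⟨ cancel F p (constP c) ⟩
  F ⊗ p ∎
  where
  open ≋-Reasoning
  F = falling (lower p) q
  c = ℕ→ℚ (suc q)
  cancel : ∀ F p c → F ⊗ (p ⊕ negP c) ⊕ c ⊗ F ≋ F ⊗ p
  cancel = solve-∀ poly-ring

pascal : ∀ p q → binomP p (suc q) ≋ binomP (lower p) (suc q) ⊕ binomP (lower p) q
pascal p q = begin
  ifac (suc q) · falling p (suc q)
    ≈⟨ ·-cong refl (falling-lower p q) ⟩
  ifac (suc q) · (p ⊗ F)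
    ≈⟨ ·-cong refl (≋-trans (⊗-comm p F) (≋-sym (falling-split p q))) ⟩
  ifac (suc q) · (falling (lower p) (suc q) ⊕ ℕ→ℚ (suc q) · F)
    ≈⟨ ·-distrib (ifac (suc q)) (falling (lower p) (suc q)) (ℕ→ℚ (suc q) · F) ⟩
  ifac (suc q) · falling (lower p) (suc q) ⊕ ifac (suc q) · (ℕ→ℚ (suc q) · F)
    ≈⟨ ⊕-cong (≋-refl {binomP (lower p) (suc q)})
              (≋-trans (·-assoc (ifac (suc q)) _ F) (·-cong (trans (*-comm (ifac (suc q)) (ℕ→ℚ (suc q))) (ifac-suc q)) ≋-refl)) ⟩
  ifac (suc q) · falling (lower p) (suc q) ⊕ ifac q · F
    ∎
  where
  open ≋-Reasoning
  F = falling (lower p) q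

absorption : ∀ p q → ℕ→ℚ (suc q) · binomP p (suc q) ≋ binomP p q ⊗ (p ⊕ constP (- ℕ→ℚ q))
absorption p q = begin
  ℕ→ℚ (suc q) · (ifac (suc q) · (falling p q ⊗ Y))  ≈⟨ ·-assoc (ℕ→ℚ (suc q)) (ifac (suc q)) _ ⟩
  (ℕ→ℚ (suc q) * ifac (suc q)) · (falling p q ⊗ Y)  ≈⟨ ·-cong (ifac-suc q) ≋-refl ⟩
  ifac q · (falling p q ⊗ Y)                        ≈⟨ ⊗-scaleˡ (ifac q) (falling p q) Y ⟨
  (ifac q · falling p q) ⊗ Y                        ∎
  where
  open ≋-Reasoning
  Y = p ⊕ constP (- ℕ→ℚ q)

-- If K = c + (i+1), then K(z+1) - 1 - i = Kz + c; both sides have coefficient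
-- list [K - 1 - i, K].
lowered-top : ∀ K c i → K ≡ c + ℕ→ℚ (suc i) →
  lower (K · (Z ⊕ constP (ℕ→ℚ 1))) ⊕ constP (- ℕ→ℚ i) ≋ constP K ⊗ Z ⊕ constP c
lowered-top _ c i refl = ∷-cong constant-term ≋-refl
  where
  collect : ∀ c i → ((c + (1ℚ + i)) * 1ℚ + - 1ℚ) + - i ≡ ((c + (1ℚ + i)) * 0ℚ + 0ℚ) + c
  collect = solve-∀ ℚ-ring
  constant-term : ((c + ℕ→ℚ (suc i)) * 1ℚ + - 1ℚ) + - ℕ→ℚ i ≡ ((c + ℕ→ℚ (suc i)) * 0ℚ + 0ℚ) + c
  constant-term rewrite ℕ→ℚ-+ 1 i = collect c (ℕ→ℚ i)

module Telescope (m : ℕ) where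

  K : ℚ
  K = ℕ→ℚ (suc m)

  N : Poly
  N = K · (Z ⊕ constP (ℕ→ℚ 1))

  M : Poly
  M = lower N

  summand : ℕ → Poly
  summand q = ℕ→ℚ (suc m ∸ q) · (binomP N q ⊗ (Z ^P (suc m ∸ q ∸ 1)))

  K-split : ∀ i d → suc i ℕ.+ d ≡ m → K ≡ ℕ→ℚ (suc d) + ℕ→ℚ (suc i)
  K-split i d e =
    trans (cong (λ n → ℕ→ℚ (suc n)) (trans (sym e) (ℕₚ.+-comm (suc i) d))) (ℕ→ℚ-+ (suc d) (suc i))

  -- After Pascal's rule the left side is z^d (C(M,i)(kz + d+1) + (d+1) C(M,i+1)),
  -- and C(M,i)(kz + d+1) = C(M,i)(M-i) = (i+1) C(M,i+1) by absorption.
  step : ∀ i d → suc i ℕ.+ d ≡ m →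
    K · (binomP M i ⊗ Z ^P suc d) ⊕ ℕ→ℚ (suc d) · (binomP N (suc i) ⊗ Z ^P d)
      ≋ K · (binomP M (suc i) ⊗ Z ^P d)
  step i d e = begin
    K · (A ⊗ (Z ⊗ E)) ⊕ c · (binomP N (suc i) ⊗ E)
      ≈⟨ ⊕-cong (·-as-⊗ K (A ⊗ (Z ⊗ E)))
                (≋-trans (·-as-⊗ c _) (⊗-cong (≋-refl {constP c}) (⊗-cong (pascal N i) (≋-refl {E})))) ⟩
    constP K ⊗ (A ⊗ (Z ⊗ E)) ⊕ constP c ⊗ ((B ⊕ A) ⊗ E)
      ≈⟨ gather (constP K) (constP c) A B Z E ⟩
    E ⊗ (A ⊗ (constP K ⊗ Z ⊕ constP c)) ⊕ constP c ⊗ (B ⊗ E)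
      ≈⟨ ⊕-cong (⊗-cong (≋-refl {E}) absorbed) (≋-refl {constP c ⊗ (B ⊗ E)}) ⟩
    E ⊗ (constP j ⊗ B) ⊕ constP c ⊗ (B ⊗ E)
      ≈⟨ regather E (constP j) B (constP c) ⟩
    (constP c ⊕ constP j) ⊗ (B ⊗ E)
      ≈⟨ ⊗-cong {p = constP c ⊕ constP j} (∷-cong (sym (K-split i d e)) ≋-refl) (≋-refl {B ⊗ E}) ⟩
    constP K ⊗ (B ⊗ E)
      ≈⟨ ·-as-⊗ K (B ⊗ E) ⟨
    K · (B ⊗ E)
      ∎
    where
    open ≋-Reasoning
    A = binomP M i
    B = binomP M (suc i)
    E = Z ^P d
    c = ℕ→ℚ (suc d)
    j = ℕ→ℚ (suc i)
    absorbed : A ⊗ (constP K ⊗ Z ⊕ constP c) ≋ constP j ⊗ B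
    absorbed = ≋-trans (⊗-cong (≋-refl {A}) (≋-sym (lowered-top K c i (K-split i d e))))
                       (≋-trans (≋-sym (absorption M i)) (·-as-⊗ j B))
    gather : ∀ K c A B Z E →
      K ⊗ (A ⊗ (Z ⊗ E)) ⊕ c ⊗ ((B ⊕ A) ⊗ E) ≋ E ⊗ (A ⊗ (K ⊗ Z ⊕ c)) ⊕ c ⊗ (B ⊗ E)
    gather = solve-∀ poly-ring
    regather : ∀ E j B c → E ⊗ (j ⊗ B) ⊕ c ⊗ (B ⊗ E) ≋ (c ⊕ j) ⊗ (B ⊗ E)
    regather = solve-∀ poly-ring

  partial-sum : ∀ i d → i ℕ.+ d ≡ m → sumP (suc i) summand ≋ K · (binomP M i ⊗ Z ^P d)
  partial-sum zero    d refl = ≋-refl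
  partial-sum (suc i) d e    = begin
    sumP (suc i) summand ⊕ summand (suc i)
      ≈⟨ ⊕-cong (partial-sum i (suc d) e′) (≋-reflexive (cong weighted m∸i≡1+d)) ⟩
    K · (binomP M i ⊗ Z ^P suc d) ⊕ ℕ→ℚ (suc d) · (binomP N (suc i) ⊗ Z ^P d)
      ≈⟨ step i d e ⟩
    K · (binomP M (suc i) ⊗ Z ^P d)
      ∎
    where
    open ≋-Reasoning
    e′ : i ℕ.+ suc d ≡ m
    e′ = trans (ℕₚ.+-suc i d) e
    m∸i≡1+d : m ∸ i ≡ suc d
    m∸i≡1+d = trans (cong (_∸ i) (sym e′)) (ℕₚ.m+n∸m≡n i (suc d))
    weighted : ℕ → Poly
    weighted w = ℕ→ℚ w · (binomP N (suc i) ⊗ Z ^P (w ∸ 1))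

mainTheorem8 : (k : ℕ) → .{{_ : NonZero k}} →
    binomP (ℕ→ℚ k · (Z ⊕ constP (ℕ→ℚ 1)) ⊕ constP (- ℕ→ℚ 1)) (k ∸ 1)
      ≈P ((+ 1) / k) · sumP k (λ q → ℕ→ℚ (k ∸ q) · (binomP (ℕ→ℚ k · (Z ⊕ constP (ℕ→ℚ 1))) q ⊗ (Z ^P (k ∸ q ∸ 1))))
mainTheorem8 (suc m) = coeff-≡ (≋-sym (begin
  (+ 1 / suc m) · sumP (suc m) summand        ≈⟨ ·-cong refl (partial-sum m 0 (ℕₚ.+-identityʳ m)) ⟩
  (+ 1 / suc m) · (K · (binomP M m ⊗ Z ^P 0))  ≈⟨ ·-cong refl (·-cong refl (⊗-identityʳ (binomP M m))) ⟩
  (+ 1 / suc m) · (K · binomP M m)            ≈⟨ ·-assoc (+ 1 / suc m) K (binomP M m) ⟩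
  ((+ 1 / suc m) * K) · binomP M m            ≈⟨ ·-cong (inverse-ℕ→ℚ (suc m)) ≋-refl ⟩
  1ℚ · binomP M m                             ≈⟨ ·-identity (binomP M m) ⟩
  binomP M m                                  ∎))
  where
  open Telescope m
  open ≋-Reasoning
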